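{- Let $G$ be a finite simple connected graph with maximum degree $\Delta$. Then there exists an edge $e$ of $G$ with $|F(e)|=\Delta^2-1$ if and only if $G\in\mathcal{G}_\Delta$.
   Context: Two distinct edges $e,f$ are at distance $1$ if they share an endvertex, and at distance $2$ if they do not share an endvertex but some edge of $G$ shares an endvertex with each of them. For an edge $e$, $N(e)$ denotes the set of edges at distance $1$ from $e$. For an edge $e=uv$ and an edge $f=ab$ at distance $2$ from $e$, call $f$ a $2$-neighbor of Type $6$ of $e$ if exactly one of the four pairs $ua,ub,va,vb$ is an edge of $G$ (i.e. the subgraph induced by $\{u,v,a,b\}$ is a path on $4$ vertices). Define $F(e)$ to be the set of edges of $G$ at distance $1$ or $2$ from $e$, excluding the $2$-neighbors of Type $6$ of $e$; equivalently $F(e)=N(e)\cup\{f: f \text{ at distance 2 from } e \text{ and at least two of } ua,ub,va,vb \text{ are edges of } G\}$. For a positive integer $p$, $\mathcal{G}_p$ denotes the family of $p$-regular graphs on $2p$ vertices containing an edge $uv$ with $N(u)\cup N(v)=V(G)$, where $N(x)$ is the set of neighbors of vertex $x$. -}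

module Defs where

open import Data.Nat using (ℕ; zero; suc; _+_; _*_; _∸_; _⊔_; _<ᵇ_; _≡ᵇ_)
open import Data.Fin using (Fin; toℕ)
open import Data.Fin.Properties using (_≟_)
open import Data.Bool using (Bool; true; false; _∧_; _∨_; not; if_then_else_)
open import Data.List using (List; []; _∷_; length; filterᵇ; map; foldr; concatMap)
open import Data.Bool.ListAction using (any)
open import Data.List using (allFin)
open import Data.Product using (_×_; _,_; Σ; ∃)
open import Data.Sum using (_⊎_)
open import Relation.Nullary.Decidable using (does)
open import Relation.Binary.PropositionalEquality using (_≡_)

record Graph (n : ℕ) : Set where
  field
    adj    : Fin n → Fin n → Bool
    sym    : ∀ u v → adj u v ≡ adj v u
    irrefl : ∀ u → adj u u ≡ false
open Graph public

module _ {n : ℕ} (G : Graph n) where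

  _==_ : Fin n → Fin n → Bool
  x == y = does (x ≟ y)

  edges : List (Fin n × Fin n)
  edges = concatMap (λ a → map (λ b → (a , b))
            (filterᵇ (λ b → (toℕ a <ᵇ toℕ b) ∧ adj G a b) (allFin n))) (allFin n)

  degree : Fin n → ℕ
  degree v = length (filterᵇ (adj G v) (allFin n))

  maxDegree : ℕ
  maxDegree = foldr _⊔_ 0 (map degree (allFin n))

  data Reach : Fin n → Fin n → Set where
    here : ∀ {u} → Reach u u
    step : ∀ {u w v} → adj G u w ≡ true → Reach w v → Reach u v

  Connected : Set
  Connected = ∀ u v → Reach u v

  sameEdge : Fin n × Fin n → Fin n × Fin n → Bool
  sameEdge (x , y) (a , b) = ((x == a) ∧ (y == b)) ∨ ((x == b) ∧ (y == a))

  shareEnd : Fin n × Fin n → Fin n × Fin n → Bool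
  shareEnd (x , y) (a , b) = (x == a) ∨ (x == b) ∨ (y == a) ∨ (y == b)

  dist1 : Fin n × Fin n → Fin n × Fin n → Bool
  dist1 e f = not (sameEdge e f) ∧ shareEnd e f

  dist2 : Fin n × Fin n → Fin n × Fin n → Bool
  dist2 e f = not (shareEnd e f) ∧ any (λ g → shareEnd e g ∧ shareEnd g f) edges

  b2n : Bool → ℕ
  b2n true  = 1
  b2n false = 0

  crossEdges : Fin n × Fin n → Fin n × Fin n → ℕ
  crossEdges (u , v) (a , b) =
    b2n (adj G u a) + b2n (adj G u b) + b2n (adj G v a) + b2n (adj G v b)

  type6 : Fin n × Fin n → Fin n × Fin n → Bool
  type6 e f = dist2 e f ∧ (crossEdges e f ≡ᵇ 1)

  inF : Fin n × Fin n → Fin n × Fin n → Bool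
  inF e f = dist1 e f ∨ (dist2 e f ∧ not (type6 e f))

  F : Fin n × Fin n → List (Fin n × Fin n)
  F e = filterᵇ (inF e) edges

  InFamily : ℕ → Set
  InFamily p = (n ≡ 2 * p)
             × (∀ v → degree v ≡ p)
             × ∃ λ u → ∃ λ v → (adj G u v ≡ true)
                 × (∀ w → (adj G u w ≡ true) ⊎ (adj G v w ≡ true))

{-# OPTIONS --safe #-}
-- Fix an edge e = uv, let W = V ∖ {u, v}, and for x ∈ W let c(x) and d(x) be the numbers of
-- neighbours of x in {u, v} and in W. The edges at distance 1 from e are the c(x) edges at the
-- vertices x ∈ W, so |N(e)| = Σ c = deg u + deg v − 2 ≤ 2Δ − 2. An edge ab inside W lies in F(e)
-- iff c(a) + c(b) ≥ 2, so the edges of F(e) inside W number at most ½ Σ_{ab} (c(a) + c(b))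
-- = ½ Σ c(x) d(x) ≤ ½ (Δ − 1) |N(e)|, because d(x) ≤ Δ − c(x) ≤ Δ − 1 whenever c(x) ≥ 1.
-- Hence |F(e)| ≤ ½ (Δ + 1) |N(e)| ≤ Δ² − 1. Equality forces deg u = deg v = Δ, c(x) = 1 and
-- d(x) = Δ − 1 whenever c(x) ≥ 1, and c(a) + c(b) ∈ {0, 2} on the edges of W; by connectivity
-- c = 1 on all of W, which makes G Δ-regular with N(u) ∪ N(v) = V and |V| = |N(e)| + 2 = 2Δ.
-- Conversely, for such a graph every one of these inequalities is an equality.

module Submission where

open import Defs hiding (sym)
open import Data.Nat using (ℕ; _*_; _∸_)
open import Data.Fin using (Fin)
open import Data.Bool using (true)
open import Data.List using (length)
open import Data.Product using (_×_; _,_; ∃)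
open import Function.Bundles using (_⇔_; mk⇔)
open import Relation.Binary.PropositionalEquality using (_≡_)

open import Data.Bool using (Bool; false; _∧_; _∨_; not; T; T?)
open import Data.Bool.Properties using (∧-assoc; T-≡; T-∧)
open import Data.Empty using (⊥-elim)
open import Data.Fin using (zero; suc; toℕ)
open import Data.Fin.Properties using (_≟_; toℕ-injective)
open import Data.List using (List; allFin; []; _∷_; _++_; map; foldr; filterᵇ; concatMap; tabulate)
open import Data.List.Relation.Unary.Any using (Any; here; there; satisfied)
open import Data.List.Relation.Unary.Any.Properties using (any⁺; any⁻)
open import Data.Bool.ListAction using (any)
open import Data.List.Membership.Propositional using (_∈_; lose; find)
open import Data.List.Membership.Propositional.Properties
  using (∈-map⁺; ∈-map⁻; ∈-allFin; ∈-concatMap⁺; ∈-concatMap⁻; ∈-filter⁺; ∈-filter⁻)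
open import Data.List.Properties using (filter-++; length-++)
open import Data.Nat using (zero; suc; _+_; _⊔_; _≤_; _<ᵇ_; _≡ᵇ_; z≤n; s≤s)
open import Data.Nat.Tactic.RingSolver using (solve-∀)
open import Data.Nat.Properties hiding (_≟_)
open import Data.Product using (proj₁; proj₂)
open import Data.Sum using (_⊎_; inj₁; inj₂; [_,_])
open import Function using (_∘_; id; Equivalence)
open import Relation.Binary.PropositionalEquality
  using (refl; sym; trans; cong; cong₂; subst; subst₂; module ≡-Reasoning)
open import Relation.Nullary using (¬_; does; yes; no)
open import Relation.Nullary.Decidable using (dec-true; dec-false)
open import Relation.Binary.Definitions using (tri<; tri≈; tri>)

open import Algebra.Properties.Semiring.Sum +-*-semiring
  using (sum; sum-syntax; ∑-distrib-+; ∑-comm; sum-cong-≗; sum-replicate-zero; *-distribˡ-sum)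

-- Indicators and finite sums

𝟙 : Bool → ℕ
𝟙 true  = 1
𝟙 false = 0

𝟙-∧ : ∀ x y → 𝟙 (x ∧ y) ≡ 𝟙 x * 𝟙 y
𝟙-∧ true  y = sym (+-identityʳ (𝟙 y))
𝟙-∧ false y = refl

atLeastTwo : ℕ → ℕ
atLeastTwo (suc (suc _)) = 1
atLeastTwo _             = 0

-- With b "some edge links the two edges" and k the number of cross pairs, this is 𝟙[f ∈ F(e)]
-- for an edge f disjoint from e.
𝟙-∧-not-≡ᵇ1 : ∀ b k → (T b ⇔ 1 ≤ k) → 𝟙 (b ∧ not (b ∧ (k ≡ᵇ 1))) ≡ atLeastTwo k
𝟙-∧-not-≡ᵇ1 false zero          b⇔ = refl
𝟙-∧-not-≡ᵇ1 true  zero          b⇔ with Equivalence.to b⇔ _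
... | ()
𝟙-∧-not-≡ᵇ1 false (suc k)       b⇔ = ⊥-elim (Equivalence.from b⇔ (s≤s z≤n))
𝟙-∧-not-≡ᵇ1 true  (suc zero)    b⇔ = refl
𝟙-∧-not-≡ᵇ1 true  (suc (suc k)) b⇔ = refl

2*atLeastTwo≤ : ∀ k → 2 * atLeastTwo k ≤ k
2*atLeastTwo≤ zero          = z≤n
2*atLeastTwo≤ (suc zero)    = z≤n
2*atLeastTwo≤ (suc (suc k)) = s≤s (s≤s z≤n)

2*atLeastTwo-suc : ∀ k → 2 * atLeastTwo (suc k) ≡ suc k → k ≡ 1
2*atLeastTwo-suc zero          ()
2*atLeastTwo-suc (suc zero)    _ = refl
2*atLeastTwo-suc (suc (suc k)) ()

suc*[2*∸2]≡2*[^2∸1] : ∀ m → suc m * (2 * m ∸ 2) ≡ 2 * (m * m ∸ 1)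
suc*[2*∸2]≡2*[^2∸1] zero    = refl
suc*[2*∸2]≡2*[^2∸1] (suc m) = trans (cong (λ k → suc (suc m) * (k ∸ 2)) (*-suc 2 m)) (poly m)
  where
  poly : ∀ m → suc (suc m) * (2 * m) ≡ 2 * (m + m * suc m)
  poly = solve-∀

+-tight : ∀ {a b c d} → a ≤ c → b ≤ d → a + b ≡ c + d → a ≡ c × b ≡ d
+-tight {a} {b} {c} {d} a≤c b≤d eq = a≡c , +-cancelˡ-≡ c b d (trans (cong (_+ b) (sym a≡c)) eq)
  where
  a≡c : a ≡ c
  a≡c = ≤-antisym a≤c (+-cancelʳ-≤ b c a (≤-trans (+-monoʳ-≤ c b≤d) (≤-reflexive (sym eq))))

≤-chain-tight : ∀ {w x y z} → w ≤ x → x ≤ y → y ≤ z → w ≡ z → w ≡ x × x ≡ y × y ≡ z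
≤-chain-tight w≤x x≤y y≤z refl =
  ≤-antisym w≤x (≤-trans x≤y y≤z) ,
  ≤-antisym x≤y (≤-trans y≤z w≤x) ,
  ≤-antisym y≤z (≤-trans w≤x x≤y)

*-cancelˡ-≡-pos : ∀ {k x y} → 1 ≤ k → k * x ≡ k * y → x ≡ y
*-cancelˡ-≡-pos {suc k} {x} {y} _ = *-cancelˡ-≡ x y (suc k)

∑-mono-≤ : ∀ {n} {f g : Fin n → ℕ} → (∀ i → f i ≤ g i) → sum f ≤ sum g
∑-mono-≤ {zero}  _   = z≤n
∑-mono-≤ {suc n} f≤g = +-mono-≤ (f≤g zero) (∑-mono-≤ (f≤g ∘ suc))

∑-tight : ∀ {n} {f g : Fin n → ℕ} → (∀ i → f i ≤ g i) → sum f ≡ sum g → ∀ i → f i ≡ g i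
∑-tight f≤g eq zero    = proj₁ (+-tight (f≤g zero) (∑-mono-≤ (f≤g ∘ suc)) eq)
∑-tight f≤g eq (suc i) = ∑-tight (f≤g ∘ suc) (proj₂ (+-tight (f≤g zero) (∑-mono-≤ (f≤g ∘ suc)) eq)) i

∑-≡⇔ : ∀ {n} {f g : Fin n → ℕ} → (∀ i → f i ≤ g i) → sum f ≡ sum g ⇔ (∀ i → f i ≡ g i)
∑-≡⇔ f≤g = mk⇔ (∑-tight f≤g) sum-cong-≗

∑∑-≡⇔ : ∀ {m n} {f g : Fin m → Fin n → ℕ} → (∀ i j → f i j ≤ g i j) →
  ∑[ i < m ] ∑[ j < n ] f i j ≡ ∑[ i < m ] ∑[ j < n ] g i j ⇔ (∀ i j → f i j ≡ g i j)
∑∑-≡⇔ f≤g = mk⇔ (λ eq i → ∑-tight (f≤g i) (∑-tight (λ i → ∑-mono-≤ (f≤g i)) eq i))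
                (λ f≗g → sum-cong-≗ (λ i → sum-cong-≗ (f≗g i)))

∑-const-1 : ∀ n → ∑[ i < n ] 1 ≡ n
∑-const-1 zero    = refl
∑-const-1 (suc n) = cong suc (∑-const-1 n)

≟-refl : ∀ {n} (x : Fin n) → does (x ≟ x) ≡ true
≟-refl x = dec-true (x ≟ x) refl

≟-≢ : ∀ {n} {x y : Fin n} → ¬ x ≡ y → does (x ≟ y) ≡ false
≟-≢ {x = x} {y} = dec-false (x ≟ y)

∑-δ : ∀ {n} (f : Fin n → ℕ) x → ∑[ i < n ] (𝟙 (does (i ≟ x)) * f i) ≡ f x
∑-δ {suc n} f zero    = trans (cong₂ _+_ (+-identityʳ (f zero)) (sum-replicate-zero n)) (+-identityʳ (f zero))
∑-δ {suc n} f (suc x) = ∑-δ (f ∘ suc) x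

∑∑-distrib-+ : ∀ {m n} (f g : Fin m → Fin n → ℕ) →
  ∑[ i < m ] ∑[ j < n ] (f i j + g i j) ≡ ∑[ i < m ] ∑[ j < n ] f i j + ∑[ i < m ] ∑[ j < n ] g i j
∑∑-distrib-+ f g = trans (sum-cong-≗ (λ i → ∑-distrib-+ (f i) (g i))) (∑-distrib-+ (sum ∘ f) (sum ∘ g))

𝟙-<ᵇ-total : ∀ {x y} → ¬ x ≡ y → 𝟙 (x <ᵇ y) + 𝟙 (y <ᵇ x) ≡ 1
𝟙-<ᵇ-total {zero}  {zero}  x≢y = ⊥-elim (x≢y refl)
𝟙-<ᵇ-total {zero}  {suc y} x≢y = refl
𝟙-<ᵇ-total {suc x} {zero}  x≢y = refl
𝟙-<ᵇ-total {suc x} {suc y} x≢y = 𝟙-<ᵇ-total (x≢y ∘ cong suc)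

∑∑-symmetric : ∀ {n} (M : Fin n → Fin n → ℕ) → (∀ a b → M a b ≡ M b a) → (∀ a → M a a ≡ 0) →
  ∑[ a < n ] ∑[ b < n ] M a b ≡ 2 * ∑[ a < n ] ∑[ b < n ] (𝟙 (toℕ a <ᵇ toℕ b) * M a b)
∑∑-symmetric {n} M M-sym M-diag = begin
    ∑[ a < n ] ∑[ b < n ] M a b
  ≡⟨ sum-cong-≗ (λ a → sum-cong-≗ (split a)) ⟩
    ∑[ a < n ] ∑[ b < n ] (below a b + below b a)
  ≡⟨ ∑∑-distrib-+ below (λ a b → below b a) ⟩
    U + ∑[ a < n ] ∑[ b < n ] below b a
  ≡⟨ cong (U +_) (∑-comm (λ a b → below b a)) ⟩
    U + U
  ≡⟨ cong (U +_) (sym (+-identityʳ U)) ⟩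
    2 * U
  ∎
  where
  open ≡-Reasoning
  below : Fin n → Fin n → ℕ
  below a b = 𝟙 (toℕ a <ᵇ toℕ b) * M a b
  U : ℕ
  U = ∑[ a < n ] ∑[ b < n ] below a b
  split : ∀ a b → M a b ≡ below a b + below b a
  split a b with a ≟ b
  ... | yes refl = trans (M-diag a) (sym (cong₂ _+_ below-diag below-diag))
    where
    below-diag : below a a ≡ 0
    below-diag = trans (cong (𝟙 (toℕ a <ᵇ toℕ a) *_) (M-diag a)) (*-zeroʳ (𝟙 (toℕ a <ᵇ toℕ a)))
  ... | no a≢b   = begin
      M a b
    ≡⟨ sym (*-identityˡ (M a b)) ⟩
      1 * M a b
    ≡⟨ cong (_* M a b) (sym (𝟙-<ᵇ-total (a≢b ∘ toℕ-injective))) ⟩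
      (𝟙 (toℕ a <ᵇ toℕ b) + 𝟙 (toℕ b <ᵇ toℕ a)) * M a b
    ≡⟨ *-distribʳ-+ (M a b) (𝟙 (toℕ a <ᵇ toℕ b)) _ ⟩
      below a b + 𝟙 (toℕ b <ᵇ toℕ a) * M a b
    ≡⟨ cong (λ m → below a b + 𝟙 (toℕ b <ᵇ toℕ a) * m) (M-sym a b) ⟩
      below a b + below b a
    ∎

-- Counting in lists

private
  variable
    X Y : Set

length-filterᵇ-++ : (p : X → Bool) (xs ys : List X) →
  length (filterᵇ p (xs ++ ys)) ≡ length (filterᵇ p xs) + length (filterᵇ p ys)
length-filterᵇ-++ p xs ys = trans (cong length (filter-++ (T? ∘ p) xs ys)) (length-++ (filterᵇ p xs))

length-filterᵇ-map : (p : Y → Bool) (f : X → Y) (xs : List X) →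
  length (filterᵇ p (map f xs)) ≡ length (filterᵇ (p ∘ f) xs)
length-filterᵇ-map p f []       = refl
length-filterᵇ-map p f (x ∷ xs) with p (f x)
... | true  = cong suc (length-filterᵇ-map p f xs)
... | false = length-filterᵇ-map p f xs

length-filterᵇ-filterᵇ : (p q : X → Bool) (xs : List X) →
  length (filterᵇ p (filterᵇ q xs)) ≡ length (filterᵇ (λ x → q x ∧ p x) xs)
length-filterᵇ-filterᵇ p q []       = refl
length-filterᵇ-filterᵇ p q (x ∷ xs) with q x
... | false = length-filterᵇ-filterᵇ p q xs
... | true with p x
...   | true  = cong suc (length-filterᵇ-filterᵇ p q xs)
...   | false = length-filterᵇ-filterᵇ p q xs

length-filterᵇ-tabulate : ∀ {n} (p : X → Bool) (f : Fin n → X) →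
  length (filterᵇ p (tabulate f)) ≡ ∑[ i < n ] 𝟙 (p (f i))
length-filterᵇ-tabulate {n = zero}  p f = refl
length-filterᵇ-tabulate {n = suc n} p f with p (f zero)
... | true  = cong suc (length-filterᵇ-tabulate p (f ∘ suc))
... | false = length-filterᵇ-tabulate p (f ∘ suc)

length-filterᵇ-concatMap : ∀ {n} (p : Y → Bool) (h : X → List Y) (f : Fin n → X) →
  length (filterᵇ p (concatMap h (tabulate f))) ≡ ∑[ i < n ] length (filterᵇ p (h (f i)))
length-filterᵇ-concatMap {n = zero}  p h f = refl
length-filterᵇ-concatMap {n = suc n} p h f =
  trans (length-filterᵇ-++ p (h (f zero)) _) (cong (_ +_) (length-filterᵇ-concatMap p h (f ∘ suc)))

∈⇒≤-foldr-⊔ : ∀ {x xs} → x ∈ xs → x ≤ foldr _⊔_ 0 xs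
∈⇒≤-foldr-⊔ (here refl) = m≤m⊔n _ _
∈⇒≤-foldr-⊔ (there x∈xs) = ≤-trans (∈⇒≤-foldr-⊔ x∈xs) (m≤n⊔m _ _)

𝟙-injective : ∀ {x y} → 𝟙 x ≡ 𝟙 y → x ≡ y
𝟙-injective {true}  {true}  _ = refl
𝟙-injective {false} {false} _ = refl

-- Edges of a finite simple graph

module Adjacency {n : ℕ} (G : Graph n) where

  A : Fin n → Fin n → ℕ
  A a b = 𝟙 (adj G a b)

  A-sym : ∀ a b → A a b ≡ A b a
  A-sym a b = cong 𝟙 (Graph.sym G a b)

  A-irrefl : ∀ a → A a a ≡ 0
  A-irrefl a = cong 𝟙 (irrefl G a)

  adj⇒≢ : ∀ {a b} → adj G a b ≡ true → ¬ a ≡ b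
  adj⇒≢ {a} ab refl with trans (sym ab) (irrefl G a)
  ... | ()

  b2n≗𝟙 : ∀ x → b2n G x ≡ 𝟙 x
  b2n≗𝟙 true  = refl
  b2n≗𝟙 false = refl

  degree≡∑A : ∀ a → degree G a ≡ ∑[ b < n ] A a b
  degree≡∑A a = length-filterᵇ-tabulate (adj G a) id

  degree≤maxDegree : ∀ a → degree G a ≤ maxDegree G
  degree≤maxDegree a = ∈⇒≤-foldr-⊔ (∈-map⁺ (degree G) (∈-allFin a))

  private
    ordered : Fin n → Fin n → Bool
    ordered a b = (toℕ a <ᵇ toℕ b) ∧ adj G a b

    row : Fin n → List (Fin n × Fin n)
    row a = map (a ,_) (filterᵇ (ordered a) (allFin n))

  ∈-edges⁻ : ∀ {a b} → (a , b) ∈ edges G → adj G a b ≡ true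
  ∈-edges⁻ ab∈ with satisfied (∈-concatMap⁻ row {allFin n} ab∈)
  ... | a , ab∈row with ∈-map⁻ (a ,_) ab∈row
  ...   | b , b∈ , refl =
    Equivalence.to T-≡ (proj₂ (Equivalence.to T-∧ (proj₂ (∈-filter⁻ (T? ∘ ordered a) {xs = allFin n} b∈))))

  ∈-edges⁺ : ∀ {a b} → T (toℕ a <ᵇ toℕ b) → adj G a b ≡ true → (a , b) ∈ edges G
  ∈-edges⁺ {a} {b} a<b ab = ∈-concatMap⁺ row {allFin n} (lose (∈-allFin a) (∈-map⁺ (a ,_)
    (∈-filter⁺ (T? ∘ ordered a) (∈-allFin b) (Equivalence.from T-∧ (a<b , Equivalence.from T-≡ ab)))))

  adj⇒∈-edges : ∀ {a b} → adj G a b ≡ true → (a , b) ∈ edges G ⊎ (b , a) ∈ edges G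
  adj⇒∈-edges {a} {b} ab with <-cmp (toℕ a) (toℕ b)
  ... | tri< a<b _ _ = inj₁ (∈-edges⁺ (<⇒<ᵇ a<b) ab)
  ... | tri≈ _ a≡b _ = ⊥-elim (adj⇒≢ ab (toℕ-injective a≡b))
  ... | tri> _ _ b<a = inj₂ (∈-edges⁺ (<⇒<ᵇ b<a) (trans (Graph.sym G b a) ab))

  length-filterᵇ-edges : ∀ p → length (filterᵇ p (edges G)) ≡
    ∑[ a < n ] ∑[ b < n ] (𝟙 (toℕ a <ᵇ toℕ b) * 𝟙 (adj G a b ∧ p (a , b)))
  length-filterᵇ-edges p = trans (length-filterᵇ-concatMap p row id) (sum-cong-≗ λ a → begin
      length (filterᵇ p (row a))
    ≡⟨ length-filterᵇ-map p (a ,_) (filterᵇ (ordered a) (allFin n)) ⟩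
      length (filterᵇ (p ∘ (a ,_)) (filterᵇ (ordered a) (allFin n)))
    ≡⟨ length-filterᵇ-filterᵇ (p ∘ (a ,_)) (ordered a) (allFin n) ⟩
      length (filterᵇ (λ b → ordered a b ∧ p (a , b)) (allFin n))
    ≡⟨ length-filterᵇ-tabulate (λ b → ordered a b ∧ p (a , b)) id ⟩
      ∑[ b < n ] 𝟙 (ordered a b ∧ p (a , b))
    ≡⟨ sum-cong-≗ (λ b → trans (cong 𝟙 (∧-assoc (toℕ a <ᵇ toℕ b) (adj G a b) (p (a , b))))
                              (𝟙-∧ (toℕ a <ᵇ toℕ b) _)) ⟩
      ∑[ b < n ] (𝟙 (toℕ a <ᵇ toℕ b) * 𝟙 (adj G a b ∧ p (a , b)))
    ∎)
    where open ≡-Reasoning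

  2*length-filterᵇ-edges : ∀ p → (∀ {a b} → adj G a b ≡ true → p (a , b) ≡ p (b , a)) →
    2 * length (filterᵇ p (edges G)) ≡ ∑[ a < n ] ∑[ b < n ] 𝟙 (adj G a b ∧ p (a , b))
  2*length-filterᵇ-edges p p-sym =
    sym (trans (∑∑-symmetric M M-sym M-diag) (cong (2 *_) (sym (length-filterᵇ-edges p))))
    where
    M : Fin n → Fin n → ℕ
    M a b = 𝟙 (adj G a b ∧ p (a , b))
    M-sym : ∀ a b → M a b ≡ M b a
    M-sym a b rewrite Graph.sym G a b with adj G b a in ba
    ... | true  = cong 𝟙 (p-sym (trans (Graph.sym G a b) ba))
    ... | false = refl
    M-diag : ∀ a → M a a ≡ 0
    M-diag a rewrite irrefl G a = refl

  Endpoint : Fin n → Fin n × Fin n → Set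
  Endpoint x (a , b) = x ≡ a ⊎ x ≡ b

  Meets : Fin n × Fin n → Fin n × Fin n → Set
  Meets (x , y) f = Endpoint x f ⊎ Endpoint y f

  shareEnd⇒Meets : ∀ e f → T (shareEnd G e f) → Meets e f
  shareEnd⇒Meets (x , y) (a , b) t with x ≟ a | x ≟ b | y ≟ a | y ≟ b
  ... | yes x≡a | _       | _       | _       = inj₁ (inj₁ x≡a)
  ... | no _    | yes x≡b | _       | _       = inj₁ (inj₂ x≡b)
  ... | no _    | no _    | yes y≡a | _       = inj₂ (inj₁ y≡a)
  ... | no _    | no _    | no _    | yes y≡b = inj₂ (inj₂ y≡b)

  Meets⇒shareEnd : ∀ e f → Meets e f → T (shareEnd G e f)
  Meets⇒shareEnd (x , y) (a , b) m with x ≟ a | x ≟ b | y ≟ a | y ≟ b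
  ... | yes _ | _     | _     | _     = _
  ... | no _  | yes _ | _     | _     = _
  ... | no _  | no _  | yes _ | _     = _
  ... | no _  | no _  | no _  | yes _ = _
  ... | no x≢a | no x≢b | no y≢a | no y≢b = [ [ x≢a , x≢b ] , [ y≢a , y≢b ] ] m

  Meets-sym : ∀ e f → Meets e f → Meets f e
  Meets-sym _ _ (inj₁ (inj₁ refl)) = inj₁ (inj₁ refl)
  Meets-sym _ _ (inj₁ (inj₂ refl)) = inj₂ (inj₁ refl)
  Meets-sym _ _ (inj₂ (inj₁ refl)) = inj₁ (inj₂ refl)
  Meets-sym _ _ (inj₂ (inj₂ refl)) = inj₂ (inj₂ refl)

  Crossing : Fin n × Fin n → Fin n × Fin n → Set
  Crossing e f = ∃ λ s → ∃ λ t → adj G s t ≡ true × Endpoint s e × Endpoint t f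

  linked : Fin n × Fin n → Fin n × Fin n → Fin n × Fin n → Bool
  linked e f g = shareEnd G e g ∧ shareEnd G g f

  private
    common⇒Meets : ∀ {x} e f → Endpoint x e → Endpoint x f → Meets e f
    common⇒Meets _ _ (inj₁ refl) xf = inj₁ xf
    common⇒Meets _ _ (inj₂ refl) xf = inj₂ xf

  any-linked⇒Crossing : ∀ e f → ¬ Meets e f → T (any (linked e f) (edges G)) → Crossing e f
  any-linked⇒Crossing e f e∤f t with find (any⁻ (linked e f) (edges G) t)
  ... | (x , y) , xy∈ , eg∧gf
    with Equivalence.to T-∧ eg∧gf
  ... | eg , gf
    with Meets-sym e (x , y) (shareEnd⇒Meets e (x , y) eg) | shareEnd⇒Meets (x , y) f gf
  ... | inj₁ xe | inj₁ xf = ⊥-elim (e∤f (common⇒Meets e f xe xf))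
  ... | inj₁ xe | inj₂ yf = x , y , ∈-edges⁻ xy∈ , xe , yf
  ... | inj₂ ye | inj₁ xf = y , x , trans (Graph.sym G y x) (∈-edges⁻ xy∈) , ye , xf
  ... | inj₂ ye | inj₂ yf = ⊥-elim (e∤f (common⇒Meets e f ye yf))

  Crossing⇒any-linked : ∀ e f → Crossing e f → T (any (linked e f) (edges G))
  Crossing⇒any-linked e f (s , t , st , se , tf) = any⁺ (linked e f) (Any-linked (adj⇒∈-edges st))
    where
    link : ∀ g → Meets g e → Meets g f → T (linked e f g)
    link g ge gf = Equivalence.from T-∧ (Meets⇒shareEnd e g (Meets-sym g e ge) , Meets⇒shareEnd g f gf)
    Any-linked : (s , t) ∈ edges G ⊎ (t , s) ∈ edges G → Any (T ∘ linked e f) (edges G)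
    Any-linked (inj₁ st∈) = lose st∈ (link (s , t) (inj₁ se) (inj₂ tf))
    Any-linked (inj₂ ts∈) = lose ts∈ (link (t , s) (inj₂ se) (inj₁ tf))

-- The edges around a fixed edge e = uv

module AroundEdge {n : ℕ} (G : Graph n) {u v : Fin n} (uv : adj G u v ≡ true) where

  open Adjacency G

  Δ : ℕ
  Δ = maxDegree G

  u≢v : ¬ u ≡ v
  u≢v = adj⇒≢ uv

  data Position (x : Fin n) : Set where
    at-u    : x ≡ u → Position x
    at-v    : x ≡ v → Position x
    outside : ¬ x ≡ u → ¬ x ≡ v → Position x

  position : ∀ x → Position x
  position x with x ≟ u | x ≟ v
  ... | yes x≡u | _       = at-u x≡u
  ... | no _    | yes x≡v = at-v x≡v
  ... | no x≢u  | no x≢v  = outside x≢u x≢v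

  -- offEdge is the indicator of W, toEdge x = c(x) and toOff x = d(x); cut = |N(e)|, cutAt x is
  -- its share at x, farF counts the edges of F(e) inside W as ordered pairs (so twice), and
  -- cutPaths = Σ c(x) d(x).
  onEdge : Fin n → ℕ
  onEdge x = 𝟙 (does (x ≟ u)) + 𝟙 (does (x ≟ v))

  offEdge : Fin n → ℕ
  offEdge x = 𝟙 (not (does (x ≟ u) ∨ does (x ≟ v)))

  private
    weights : ∀ x {p q} → does (x ≟ u) ≡ p → does (x ≟ v) ≡ q →
      offEdge x ≡ 𝟙 (not (p ∨ q)) × onEdge x ≡ 𝟙 p + 𝟙 q
    weights x refl refl = refl , refl

    weights-u : offEdge u ≡ 0 × onEdge u ≡ 1
    weights-u = weights u (≟-refl u) (≟-≢ u≢v)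

    weights-v : offEdge v ≡ 0 × onEdge v ≡ 1
    weights-v = weights v (≟-≢ (u≢v ∘ sym)) (≟-refl v)

    weights-outside : ∀ {x} → ¬ x ≡ u → ¬ x ≡ v → offEdge x ≡ 1 × onEdge x ≡ 0
    weights-outside {x} x≢u x≢v = weights x (≟-≢ x≢u) (≟-≢ x≢v)

  offEdge-u : offEdge u ≡ 0
  offEdge-u = proj₁ weights-u

  offEdge-v : offEdge v ≡ 0
  offEdge-v = proj₁ weights-v

  offEdge-outside : ∀ {x} → ¬ x ≡ u → ¬ x ≡ v → offEdge x ≡ 1
  offEdge-outside x≢u x≢v = proj₁ (weights-outside x≢u x≢v)

  offEdge+onEdge : ∀ x → offEdge x + onEdge x ≡ 1
  offEdge+onEdge x with position x
  ... | at-u refl = cong₂ _+_ (proj₁ weights-u) (proj₂ weights-u)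
  ... | at-v refl = cong₂ _+_ (proj₁ weights-v) (proj₂ weights-v)
  ... | outside x≢u x≢v = cong₂ _+_ (proj₁ (weights-outside x≢u x≢v)) (proj₂ (weights-outside x≢u x≢v))

  ∑-onEdge : ∀ (f : Fin n → ℕ) → ∑[ x < n ] (onEdge x * f x) ≡ f u + f v
  ∑-onEdge f = begin
      ∑[ x < n ] (onEdge x * f x)
    ≡⟨ sum-cong-≗ (λ x → *-distribʳ-+ (f x) (𝟙 (does (x ≟ u))) _) ⟩
      ∑[ x < n ] (𝟙 (does (x ≟ u)) * f x + 𝟙 (does (x ≟ v)) * f x)
    ≡⟨ ∑-distrib-+ (λ x → 𝟙 (does (x ≟ u)) * f x) (λ x → 𝟙 (does (x ≟ v)) * f x) ⟩
      ∑[ x < n ] (𝟙 (does (x ≟ u)) * f x) + ∑[ x < n ] (𝟙 (does (x ≟ v)) * f x)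
    ≡⟨ cong₂ _+_ (∑-δ f u) (∑-δ f v) ⟩
      f u + f v
    ∎
    where open ≡-Reasoning

  ∑-offEdge+2 : ∑[ x < n ] offEdge x + 2 ≡ n
  ∑-offEdge+2 = begin
      sum offEdge + 2
    ≡⟨ cong (sum offEdge +_) (sym (∑-onEdge (λ _ → 1))) ⟩
      sum offEdge + ∑[ x < n ] (onEdge x * 1)
    ≡⟨ cong (sum offEdge +_) (sum-cong-≗ (λ x → *-identityʳ (onEdge x))) ⟩
      sum offEdge + sum onEdge
    ≡⟨ sym (∑-distrib-+ offEdge onEdge) ⟩
      ∑[ x < n ] (offEdge x + onEdge x)
    ≡⟨ sum-cong-≗ offEdge+onEdge ⟩
      ∑[ x < n ] 1
    ≡⟨ ∑-const-1 n ⟩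
      n
    ∎
    where open ≡-Reasoning

  toEdge : Fin n → ℕ
  toEdge x = A u x + A v x

  toOff : Fin n → ℕ
  toOff x = ∑[ y < n ] (A x y * offEdge y)

  degree-split : ∀ x → degree G x ≡ toOff x + toEdge x
  degree-split x = begin
      degree G x
    ≡⟨ degree≡∑A x ⟩
      ∑[ y < n ] A x y
    ≡⟨ sum-cong-≗ split ⟩
      ∑[ y < n ] (A x y * offEdge y + onEdge y * A x y)
    ≡⟨ ∑-distrib-+ (λ y → A x y * offEdge y) (λ y → onEdge y * A x y) ⟩
      toOff x + ∑[ y < n ] (onEdge y * A x y)
    ≡⟨ cong (toOff x +_) (∑-onEdge (A x)) ⟩
      toOff x + (A x u + A x v)
    ≡⟨ cong (toOff x +_) (cong₂ _+_ (A-sym x u) (A-sym x v)) ⟩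
      toOff x + toEdge x
    ∎
    where
    open ≡-Reasoning
    distribute : ∀ a p q → a * (p + q) ≡ a * p + q * a
    distribute = solve-∀
    split : ∀ y → A x y ≡ A x y * offEdge y + onEdge y * A x y
    split y = trans (sym (trans (cong (A x y *_) (offEdge+onEdge y)) (*-identityʳ (A x y))))
                    (distribute (A x y) (offEdge y) (onEdge y))

  toEdge-u : toEdge u ≡ 1
  toEdge-u = cong₂ _+_ (A-irrefl u) (cong 𝟙 (trans (Graph.sym G v u) uv))

  toEdge-v : toEdge v ≡ 1
  toEdge-v = cong₂ _+_ (cong 𝟙 uv) (A-irrefl v)

  cutAt : Fin n → ℕ
  cutAt x = offEdge x * toEdge x

  cut : ℕ
  cut = ∑[ x < n ] cutAt x

  cut≡toOff+toOff : cut ≡ toOff u + toOff v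
  cut≡toOff+toOff = trans (sum-cong-≗ distribute) (∑-distrib-+ (λ x → A u x * offEdge x) _)
    where
    distribute : ∀ x → offEdge x * toEdge x ≡ A u x * offEdge x + A v x * offEdge x
    distribute x = trans (*-distribˡ-+ (offEdge x) (A u x) (A v x))
                         (cong₂ _+_ (*-comm (offEdge x) (A u x)) (*-comm (offEdge x) (A v x)))

  cut+2≡degree+degree : cut + 2 ≡ degree G u + degree G v
  cut+2≡degree+degree = begin
      cut + 2
    ≡⟨ cong (_+ 2) cut≡toOff+toOff ⟩
      toOff u + toOff v + 2
    ≡⟨ shuffle (toOff u) (toOff v) ⟩
      (toOff u + 1) + (toOff v + 1)
    ≡⟨ sym (cong₂ (λ p q → (toOff u + p) + (toOff v + q)) toEdge-u toEdge-v) ⟩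
      (toOff u + toEdge u) + (toOff v + toEdge v)
    ≡⟨ sym (cong₂ _+_ (degree-split u) (degree-split v)) ⟩
      degree G u + degree G v
    ∎
    where
    open ≡-Reasoning
    shuffle : ∀ p q → p + q + 2 ≡ (p + 1) + (q + 1)
    shuffle = solve-∀

  Crossing⇔1≤toEdge : ∀ a b → Crossing (u , v) (a , b) ⇔ 1 ≤ toEdge a + toEdge b
  Crossing⇔1≤toEdge a b = mk⇔ to from
    where
    A≤toEdge : ∀ {s t} → Endpoint s (u , v) → A s t ≤ toEdge t
    A≤toEdge {t = t} (inj₁ refl) = m≤m+n (A u t) (A v t)
    A≤toEdge {t = t} (inj₂ refl) = m≤n+m (A v t) (A u t)
    toEdge≤ : ∀ {t} → Endpoint t (a , b) → toEdge t ≤ toEdge a + toEdge b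
    toEdge≤ (inj₁ refl) = m≤m+n (toEdge a) (toEdge b)
    toEdge≤ (inj₂ refl) = m≤n+m (toEdge b) (toEdge a)
    to : Crossing (u , v) (a , b) → 1 ≤ toEdge a + toEdge b
    to (s , t , st , s∈uv , t∈ab) =
      ≤-trans (≤-reflexive (sym (cong 𝟙 st))) (≤-trans (A≤toEdge s∈uv) (toEdge≤ t∈ab))
    from : 1 ≤ toEdge a + toEdge b → Crossing (u , v) (a , b)
    from 1≤ with adj G u a in ua | adj G v a in va | adj G u b in ub | adj G v b in vb
    ... | true  | _     | _     | _     = u , a , ua , inj₁ refl , inj₁ refl
    ... | false | true  | _     | _     = v , a , va , inj₂ refl , inj₁ refl
    ... | false | false | true  | _     = u , b , ub , inj₁ refl , inj₂ refl
    ... | false | false | false | true  = v , b , vb , inj₂ refl , inj₂ refl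
    ... | false | false | false | false with 1≤
    ...   | ()

  crossEdges≡toEdge+toEdge : ∀ a b → crossEdges G (u , v) (a , b) ≡ toEdge a + toEdge b
  crossEdges≡toEdge+toEdge a b
    rewrite b2n≗𝟙 (adj G u a) | b2n≗𝟙 (adj G u b) | b2n≗𝟙 (adj G v a) | b2n≗𝟙 (adj G v b) =
    interchange (A u a) (A u b) (A v a) (A v b)
    where
    interchange : ∀ p q r s → p + q + r + s ≡ (p + r) + (q + s)
    interchange = solve-∀

  𝟙-inF-outside : ∀ {a b} → ¬ a ≡ u → ¬ a ≡ v → ¬ b ≡ u → ¬ b ≡ v →
    𝟙 (inF G (u , v) (a , b)) ≡ atLeastTwo (toEdge a + toEdge b)
  𝟙-inF-outside {a} {b} a≢u a≢v b≢u b≢v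
    rewrite ≟-≢ (a≢u ∘ sym) | ≟-≢ (a≢v ∘ sym) | ≟-≢ (b≢u ∘ sym) | ≟-≢ (b≢v ∘ sym)
          | crossEdges≡toEdge+toEdge a b =
    𝟙-∧-not-≡ᵇ1 _ (toEdge a + toEdge b) (mk⇔
      (Equivalence.to (Crossing⇔1≤toEdge a b) ∘ any-linked⇒Crossing (u , v) (a , b) disjoint)
      (Crossing⇒any-linked (u , v) (a , b) ∘ Equivalence.from (Crossing⇔1≤toEdge a b)))
    where
    disjoint : ¬ Meets (u , v) (a , b)
    disjoint = [ [ a≢u ∘ sym , b≢u ∘ sym ] , [ a≢v ∘ sym , b≢v ∘ sym ] ]

  -- An edge with exactly one endpoint in {u, v} is at distance 1 from e; one inside W is at
  -- distance 2 iff some cross pair is an edge, and of Type 6 iff exactly one is.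
  pairWeight : Fin n → Fin n → ℕ
  pairWeight a b = onEdge a * offEdge b + offEdge a * onEdge b
                 + offEdge a * offEdge b * atLeastTwo (toEdge a + toEdge b)

  𝟙-inF : ∀ {a b} → adj G a b ≡ true → 𝟙 (inF G (u , v) (a , b)) ≡ pairWeight a b
  𝟙-inF {a} {b} ab with position a | position b
  ... | at-u refl | at-u refl = ⊥-elim (adj⇒≢ ab refl)
  ... | at-v refl | at-v refl = ⊥-elim (adj⇒≢ ab refl)
  ... | at-u refl | at-v refl rewrite ≟-refl u | ≟-refl v | ≟-≢ u≢v | ≟-≢ (u≢v ∘ sym) = refl
  ... | at-v refl | at-u refl rewrite ≟-refl u | ≟-refl v | ≟-≢ u≢v | ≟-≢ (u≢v ∘ sym) = refl
  ... | at-u refl | outside b≢u b≢v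
    rewrite ≟-refl u | ≟-≢ u≢v | ≟-≢ (u≢v ∘ sym)
          | ≟-≢ b≢u | ≟-≢ b≢v | ≟-≢ (b≢u ∘ sym) | ≟-≢ (b≢v ∘ sym) = refl
  ... | at-v refl | outside b≢u b≢v
    rewrite ≟-refl v | ≟-≢ u≢v | ≟-≢ (u≢v ∘ sym)
          | ≟-≢ b≢u | ≟-≢ b≢v | ≟-≢ (b≢u ∘ sym) = refl
  ... | outside a≢u a≢v | at-u refl
    rewrite ≟-refl u | ≟-≢ u≢v | ≟-≢ (u≢v ∘ sym)
          | ≟-≢ a≢u | ≟-≢ a≢v | ≟-≢ (a≢u ∘ sym) | ≟-≢ (a≢v ∘ sym) = refl
  ... | outside a≢u a≢v | at-v refl
    rewrite ≟-refl v | ≟-≢ u≢v | ≟-≢ (u≢v ∘ sym)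
          | ≟-≢ a≢u | ≟-≢ a≢v | ≟-≢ (a≢u ∘ sym) | ≟-≢ (a≢v ∘ sym) = refl
  ... | outside a≢u a≢v | outside b≢u b≢v
    rewrite ≟-≢ a≢u | ≟-≢ a≢v | ≟-≢ b≢u | ≟-≢ b≢v =
    trans (𝟙-inF-outside a≢u a≢v b≢u b≢v) (sym (+-identityʳ _))

  pairWeight-sym : ∀ a b → pairWeight a b ≡ pairWeight b a
  pairWeight-sym a b = begin
      onEdge a * offEdge b + offEdge a * onEdge b + offEdge a * offEdge b * atLeastTwo (toEdge a + toEdge b)
    ≡⟨ cong₂ (λ p q → p + q * atLeastTwo (toEdge a + toEdge b))
         (trans (+-comm (onEdge a * offEdge b) _) (cong₂ _+_ (*-comm (offEdge a) _) (*-comm (onEdge a) _)))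
         (*-comm (offEdge a) (offEdge b)) ⟩
      onEdge b * offEdge a + offEdge b * onEdge a + offEdge b * offEdge a * atLeastTwo (toEdge a + toEdge b)
    ≡⟨ cong (λ k → onEdge b * offEdge a + offEdge b * onEdge a + offEdge b * offEdge a * atLeastTwo k)
         (+-comm (toEdge a) (toEdge b)) ⟩
      pairWeight b a
    ∎
    where open ≡-Reasoning

  𝟙-adj∧inF : ∀ a b → 𝟙 (adj G a b ∧ inF G (u , v) (a , b)) ≡ A a b * pairWeight a b
  𝟙-adj∧inF a b with adj G a b in ab
  ... | true  = trans (𝟙-inF ab) (sym (+-identityʳ (pairWeight a b)))
  ... | false = refl

  far : Fin n → Fin n → ℕ
  far a b = A a b * (offEdge a * offEdge b)

  farTerm : Fin n → Fin n → ℕ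
  farTerm a b = far a b * atLeastTwo (toEdge a + toEdge b)

  farF : ℕ
  farF = ∑[ a < n ] ∑[ b < n ] farTerm a b

  2*|F|≡2*cut+farF : 2 * length (F G (u , v)) ≡ 2 * cut + farF
  2*|F|≡2*cut+farF = begin
      2 * length (F G (u , v))
    ≡⟨ 2*length-filterᵇ-edges (inF G (u , v)) inF-sym ⟩
      ∑[ a < n ] ∑[ b < n ] 𝟙 (adj G a b ∧ inF G (u , v) (a , b))
    ≡⟨ sum-cong-≗ (λ a → sum-cong-≗ (λ b → trans (𝟙-adj∧inF a b) (expand (A a b) (onEdge a)
         (offEdge b) (offEdge a) (onEdge b) (atLeastTwo (toEdge a + toEdge b))))) ⟩
      ∑[ a < n ] ∑[ b < n ] (fromEdgeTerm a b + toEdgeTerm a b + farTerm a b)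
    ≡⟨ trans (∑∑-distrib-+ (λ a b → fromEdgeTerm a b + toEdgeTerm a b) farTerm)
             (cong (_+ farF) (∑∑-distrib-+ fromEdgeTerm toEdgeTerm)) ⟩
      ∑[ a < n ] ∑[ b < n ] fromEdgeTerm a b + ∑[ a < n ] ∑[ b < n ] toEdgeTerm a b + farF
    ≡⟨ cong (_+ farF) (cong₂ _+_ fromEdge toEdge-sum) ⟩
      cut + cut + farF
    ≡⟨ cong (_+ farF) (cong (cut +_) (sym (+-identityʳ cut))) ⟩
      2 * cut + farF
    ∎
    where
    open ≡-Reasoning
    fromEdgeTerm toEdgeTerm : Fin n → Fin n → ℕ
    fromEdgeTerm a b = onEdge a * (A a b * offEdge b)
    toEdgeTerm a b = offEdge a * (onEdge b * A a b)
    inF-sym : ∀ {a b} → adj G a b ≡ true → inF G (u , v) (a , b) ≡ inF G (u , v) (b , a)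
    inF-sym {a} {b} ab = 𝟙-injective (trans (𝟙-inF ab)
      (trans (pairWeight-sym a b) (sym (𝟙-inF (trans (Graph.sym G b a) ab)))))
    expand : ∀ x p q r s k → x * (p * q + r * s + r * q * k) ≡ p * (x * q) + r * (s * x) + x * (r * q) * k
    expand = solve-∀
    fromEdge : ∑[ a < n ] ∑[ b < n ] fromEdgeTerm a b ≡ cut
    fromEdge = begin
        ∑[ a < n ] ∑[ b < n ] (onEdge a * (A a b * offEdge b))
      ≡⟨ sum-cong-≗ (λ a → sym (*-distribˡ-sum (onEdge a) (λ b → A a b * offEdge b))) ⟩
        ∑[ a < n ] (onEdge a * toOff a)
      ≡⟨ ∑-onEdge toOff ⟩
        toOff u + toOff v
      ≡⟨ sym cut≡toOff+toOff ⟩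
        cut
      ∎
    toEdge-sum : ∑[ a < n ] ∑[ b < n ] toEdgeTerm a b ≡ cut
    toEdge-sum = sum-cong-≗ λ a → begin
        ∑[ b < n ] (offEdge a * (onEdge b * A a b))
      ≡⟨ sym (*-distribˡ-sum (offEdge a) (λ b → onEdge b * A a b)) ⟩
        offEdge a * ∑[ b < n ] (onEdge b * A a b)
      ≡⟨ cong (offEdge a *_) (trans (∑-onEdge (A a)) (cong₂ _+_ (A-sym a u) (A-sym a v))) ⟩
        offEdge a * toEdge a
      ∎

  cutPaths : ℕ
  cutPaths = ∑[ a < n ] (cutAt a * toOff a)

  far-sym : ∀ a b → far a b ≡ far b a
  far-sym a b = cong₂ _*_ (A-sym a b) (*-comm (offEdge a) (offEdge b))

  2*farF : 2 * farF ≡ ∑[ a < n ] ∑[ b < n ] (far a b * (2 * atLeastTwo (toEdge a + toEdge b)))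
  2*farF = trans (*-distribˡ-sum 2 (λ a → ∑[ b < n ] farTerm a b)) (sum-cong-≗ λ a →
             trans (*-distribˡ-sum 2 (farTerm a)) (sum-cong-≗ λ b →
               *-comm-middle 2 (far a b) (atLeastTwo (toEdge a + toEdge b))))
    where
    *-comm-middle : ∀ k x y → k * (x * y) ≡ x * (k * y)
    *-comm-middle = solve-∀

  ∑∑far*toEdge≡2*cutPaths : ∑[ a < n ] ∑[ b < n ] (far a b * (toEdge a + toEdge b)) ≡ 2 * cutPaths
  ∑∑far*toEdge≡2*cutPaths = begin
      ∑[ a < n ] ∑[ b < n ] (far a b * (toEdge a + toEdge b))
    ≡⟨ sum-cong-≗ (λ a → sum-cong-≗ (λ b → *-distribˡ-+ (far a b) (toEdge a) (toEdge b))) ⟩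
      ∑[ a < n ] ∑[ b < n ] (far a b * toEdge a + far a b * toEdge b)
    ≡⟨ ∑∑-distrib-+ (λ a b → far a b * toEdge a) (λ a b → far a b * toEdge b) ⟩
      P + ∑[ a < n ] ∑[ b < n ] (far a b * toEdge b)
    ≡⟨ cong (P +_) (trans (∑-comm (λ a b → far a b * toEdge b))
                          (sum-cong-≗ λ b → sum-cong-≗ λ a → cong (_* toEdge b) (far-sym a b))) ⟩
      P + P
    ≡⟨ cong (P +_) (sym (+-identityʳ P)) ⟩
      2 * P
    ≡⟨ cong (2 *_) (sum-cong-≗ row) ⟩
      2 * cutPaths
    ∎
    where
    open ≡-Reasoning
    P : ℕ
    P = ∑[ a < n ] ∑[ b < n ] (far a b * toEdge a)
    rearrange : ∀ x p q c → x * (p * q) * c ≡ p * c * (x * q)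
    rearrange = solve-∀
    row : ∀ a → ∑[ b < n ] (far a b * toEdge a) ≡ cutAt a * toOff a
    row a = trans (sum-cong-≗ (λ b → rearrange (A a b) (offEdge a) (offEdge b) (toEdge a)))
                  (sym (*-distribˡ-sum (offEdge a * toEdge a) (λ b → A a b * offEdge b)))

  private
    far*2*atLeastTwo≤ : ∀ a b → far a b * (2 * atLeastTwo (toEdge a + toEdge b)) ≤ far a b * (toEdge a + toEdge b)
    far*2*atLeastTwo≤ a b = *-monoʳ-≤ (far a b) (2*atLeastTwo≤ (toEdge a + toEdge b))

  farF≤cutPaths : farF ≤ cutPaths
  farF≤cutPaths = *-cancelˡ-≤ 2 (subst₂ _≤_ (sym 2*farF) ∑∑far*toEdge≡2*cutPaths
    (∑-mono-≤ λ a → ∑-mono-≤ λ b → far*2*atLeastTwo≤ a b))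

  farF≡cutPaths⇔ : farF ≡ cutPaths ⇔
    (∀ a b → far a b * (2 * atLeastTwo (toEdge a + toEdge b)) ≡ far a b * (toEdge a + toEdge b))
  farF≡cutPaths⇔ = mk⇔
    (λ eq → Equivalence.to (∑∑-≡⇔ far*2*atLeastTwo≤)
      (trans (sym 2*farF) (trans (cong (2 *_) eq) (sym ∑∑far*toEdge≡2*cutPaths))))
    (λ eqs → *-cancelˡ-≡ farF cutPaths 2
      (trans 2*farF (trans (Equivalence.from (∑∑-≡⇔ far*2*atLeastTwo≤) eqs) ∑∑far*toEdge≡2*cutPaths)))

  toOff+toEdge≤Δ : ∀ a → toOff a + toEdge a ≤ Δ
  toOff+toEdge≤Δ a = subst (_≤ Δ) (degree-split a) (degree≤maxDegree a)

  cutAt-bound : ∀ a → cutAt a * (2 + toOff a) ≤ cutAt a * suc Δ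
  cutAt-bound a with position a
  ... | at-u refl rewrite offEdge-u = z≤n
  ... | at-v refl rewrite offEdge-v = z≤n
  ... | outside a≢u a≢v rewrite offEdge-outside a≢u a≢v with toEdge a in c
  ...   | zero  = z≤n
  ...   | suc k = *-monoʳ-≤ (suc k + 0) (s≤s (begin
      suc (toOff a)      ≡⟨ +-comm 1 (toOff a) ⟩
      toOff a + 1        ≤⟨ +-monoʳ-≤ (toOff a) (s≤s z≤n) ⟩
      toOff a + suc k    ≡⟨ cong (toOff a +_) (sym c) ⟩
      toOff a + toEdge a ≤⟨ toOff+toEdge≤Δ a ⟩
      Δ                  ∎))
    where open ≤-Reasoning

  ∑cutAt*[2+toOff] : ∑[ a < n ] (cutAt a * (2 + toOff a)) ≡ 2 * cut + cutPaths
  ∑cutAt*[2+toOff] = begin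
      ∑[ a < n ] (cutAt a * (2 + toOff a))
    ≡⟨ sum-cong-≗ (λ a → distribute (cutAt a) (toOff a)) ⟩
      ∑[ a < n ] (2 * cutAt a + cutAt a * toOff a)
    ≡⟨ ∑-distrib-+ (λ a → 2 * cutAt a) (λ a → cutAt a * toOff a) ⟩
      ∑[ a < n ] (2 * cutAt a) + cutPaths
    ≡⟨ cong (_+ cutPaths) (sym (*-distribˡ-sum 2 cutAt)) ⟩
      2 * cut + cutPaths
    ∎
    where
    open ≡-Reasoning
    distribute : ∀ x y → x * (2 + y) ≡ 2 * x + x * y
    distribute = solve-∀

  ∑cutAt*sucΔ : ∑[ a < n ] (cutAt a * suc Δ) ≡ suc Δ * cut
  ∑cutAt*sucΔ = trans (sum-cong-≗ (λ a → *-comm (cutAt a) (suc Δ))) (sym (*-distribˡ-sum (suc Δ) cutAt))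

  2*cut+cutPaths≤ : 2 * cut + cutPaths ≤ suc Δ * cut
  2*cut+cutPaths≤ = subst₂ _≤_ ∑cutAt*[2+toOff] ∑cutAt*sucΔ (∑-mono-≤ cutAt-bound)

  2*cut+cutPaths≡⇔ : 2 * cut + cutPaths ≡ suc Δ * cut ⇔ (∀ a → cutAt a * (2 + toOff a) ≡ cutAt a * suc Δ)
  2*cut+cutPaths≡⇔ = mk⇔
    (λ eq → Equivalence.to (∑-≡⇔ cutAt-bound) (trans ∑cutAt*[2+toOff] (trans eq (sym ∑cutAt*sucΔ))))
    (λ eqs → trans (sym ∑cutAt*[2+toOff]) (trans (Equivalence.from (∑-≡⇔ cutAt-bound) eqs) ∑cutAt*sucΔ))

  1≤Δ : 1 ≤ Δ
  1≤Δ = ≤-trans (m≤n+m 1 (toOff u)) (subst (_≤ Δ) (cong (toOff u +_) toEdge-u) (toOff+toEdge≤Δ u))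

  2*Δ≡Δ+Δ : 2 * Δ ≡ Δ + Δ
  2*Δ≡Δ+Δ = cong (Δ +_) (+-identityʳ Δ)

  cut≤2*Δ∸2 : cut ≤ 2 * Δ ∸ 2
  cut≤2*Δ∸2 = m+n≤o⇒m≤o∸n cut (begin
      cut + 2                   ≡⟨ cut+2≡degree+degree ⟩
      degree G u + degree G v   ≤⟨ +-mono-≤ (degree≤maxDegree u) (degree≤maxDegree v) ⟩
      Δ + Δ                     ≡⟨ sym 2*Δ≡Δ+Δ ⟩
      2 * Δ                     ∎)
    where open ≤-Reasoning

  cut≡2*Δ∸2⇔ : cut ≡ 2 * Δ ∸ 2 ⇔ (degree G u ≡ Δ × degree G v ≡ Δ)
  cut≡2*Δ∸2⇔ = mk⇔
    (λ eq → +-tight (degree≤maxDegree u) (degree≤maxDegree v) (begin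
      degree G u + degree G v   ≡⟨ sym cut+2≡degree+degree ⟩
      cut + 2                   ≡⟨ cong (_+ 2) eq ⟩
      2 * Δ ∸ 2 + 2             ≡⟨ m∸n+n≡m (*-monoʳ-≤ 2 1≤Δ) ⟩
      2 * Δ                     ≡⟨ 2*Δ≡Δ+Δ ⟩
      Δ + Δ                     ∎))
    (λ (du , dv) → begin
      cut                       ≡⟨ sym (m+n∸n≡m cut 2) ⟩
      cut + 2 ∸ 2               ≡⟨ cong (_∸ 2) cut+2≡degree+degree ⟩
      degree G u + degree G v ∸ 2 ≡⟨ cong (_∸ 2) (trans (cong₂ _+_ du dv) (sym 2*Δ≡Δ+Δ)) ⟩
      2 * Δ ∸ 2                 ∎)
    where open ≡-Reasoning

  -- 2 |F(e)| = 2 cut + farF ≤ 2 cut + cutPaths ≤ (Δ + 1) cut ≤ (Δ + 1)(2Δ − 2) = 2 (Δ² − 1).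
  Extremal : Set
  Extremal = farF ≡ cutPaths × 2 * cut + cutPaths ≡ suc Δ * cut × cut ≡ 2 * Δ ∸ 2

  |F|≡Δ*Δ∸1⇔ : length (F G (u , v)) ≡ Δ * Δ ∸ 1 ⇔ Extremal
  |F|≡Δ*Δ∸1⇔ = mk⇔ to from
    where
    open ≡-Reasoning
    to : length (F G (u , v)) ≡ Δ * Δ ∸ 1 → Extremal
    to eq with ≤-chain-tight (+-monoʳ-≤ (2 * cut) farF≤cutPaths) 2*cut+cutPaths≤
                             (*-monoʳ-≤ (suc Δ) cut≤2*Δ∸2)
                 (begin
                   2 * cut + farF             ≡⟨ sym 2*|F|≡2*cut+farF ⟩
                   2 * length (F G (u , v))   ≡⟨ cong (2 *_) eq ⟩
                   2 * (Δ * Δ ∸ 1)            ≡⟨ sym (suc*[2*∸2]≡2*[^2∸1] Δ) ⟩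
                   suc Δ * (2 * Δ ∸ 2)        ∎)
    ... | e₁ , e₂ , e₃ =
      +-cancelˡ-≡ (2 * cut) farF cutPaths e₁ , e₂ , *-cancelˡ-≡ cut (2 * Δ ∸ 2) (suc Δ) e₃
    from : Extremal → length (F G (u , v)) ≡ Δ * Δ ∸ 1
    from (e₁ , e₂ , e₃) = *-cancelˡ-≡ (length (F G (u , v))) (Δ * Δ ∸ 1) 2 (begin
      2 * length (F G (u , v))   ≡⟨ 2*|F|≡2*cut+farF ⟩
      2 * cut + farF             ≡⟨ cong (2 * cut +_) e₁ ⟩
      2 * cut + cutPaths         ≡⟨ e₂ ⟩
      suc Δ * cut                ≡⟨ cong (suc Δ *_) e₃ ⟩
      suc Δ * (2 * Δ ∸ 2)        ≡⟨ suc*[2*∸2]≡2*[^2∸1] Δ ⟩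
      2 * (Δ * Δ ∸ 1)            ∎)

  cutAt-endpoint : ∀ {x} → x ≡ u ⊎ x ≡ v → cutAt x ≡ 0
  cutAt-endpoint (inj₁ refl) rewrite offEdge-u = refl
  cutAt-endpoint (inj₂ refl) rewrite offEdge-v = refl

  far-endpoint : ∀ {a b} → (a ≡ u ⊎ a ≡ v) ⊎ (b ≡ u ⊎ b ≡ v) → far a b ≡ 0
  far-endpoint {a} {b} (inj₁ (inj₁ refl)) rewrite offEdge-u = *-zeroʳ (A u b)
  far-endpoint {a} {b} (inj₁ (inj₂ refl)) rewrite offEdge-v = *-zeroʳ (A v b)
  far-endpoint {a} {b} (inj₂ (inj₁ refl)) rewrite offEdge-u | *-zeroʳ (offEdge a) = *-zeroʳ (A a u)
  far-endpoint {a} {b} (inj₂ (inj₂ refl)) rewrite offEdge-v | *-zeroʳ (offEdge a) = *-zeroʳ (A a v)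

  far-outside : ∀ {a b} → ¬ a ≡ u → ¬ a ≡ v → ¬ b ≡ u → ¬ b ≡ v → adj G a b ≡ true → far a b ≡ 1
  far-outside a≢u a≢v b≢u b≢v ab rewrite offEdge-outside a≢u a≢v | offEdge-outside b≢u b≢v | ab = refl

  cutAt-outside : ∀ {a} → ¬ a ≡ u → ¬ a ≡ v → cutAt a ≡ toEdge a
  cutAt-outside {a} a≢u a≢v rewrite offEdge-outside a≢u a≢v = +-identityʳ (toEdge a)

  extremal⇒InFamily : Connected G → Extremal → InFamily G Δ
  extremal⇒InFamily conn (farF≡ , cut-tight , cut≡) =
    n≡2*Δ , regular , u , v , uv , covered
    where
    degrees : degree G u ≡ Δ × degree G v ≡ Δ
    degrees = Equivalence.to cut≡2*Δ∸2⇔ cut≡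

    outside-tight : ∀ {a} → ¬ a ≡ u → ¬ a ≡ v → 1 ≤ toEdge a → toEdge a ≡ 1 × toOff a + 1 ≡ Δ
    outside-tight {a} a≢u a≢v 1≤c = ≤-antisym c≤1 1≤c , trans (+-comm (toOff a) 1) toOff+1≡Δ
      where
      toOff+1≡Δ : suc (toOff a) ≡ Δ
      toOff+1≡Δ = suc-injective (*-cancelˡ-≡-pos 1≤c
        (subst (λ k → k * (2 + toOff a) ≡ k * suc Δ) (cutAt-outside a≢u a≢v)
          (Equivalence.to 2*cut+cutPaths≡⇔ cut-tight a)))
      c≤1 : toEdge a ≤ 1
      c≤1 = +-cancelˡ-≤ (toOff a) (toEdge a) 1
              (subst (toOff a + toEdge a ≤_) (trans (sym toOff+1≡Δ) (+-comm 1 (toOff a))) (toOff+toEdge≤Δ a))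

    Attached : Fin n → Set
    Attached x = ¬ x ≡ u → ¬ x ≡ v → 1 ≤ toEdge x

    -- Inside W, c(x) = 1 and c(x) + c(y) ∈ {0, 2} force c(y) = 1.
    attached-step : ∀ {x y} → adj G x y ≡ true → Attached x → Attached y
    attached-step {x} {y} xy att y≢u y≢v with position x
    ... | at-u refl = ≤-trans (≤-reflexive (sym (cong 𝟙 xy))) (m≤m+n (A u y) (A v y))
    ... | at-v refl = ≤-trans (≤-reflexive (sym (cong 𝟙 xy))) (m≤n+m (A v y) (A u y))
    ... | outside x≢u x≢v = ≤-reflexive (sym (2*atLeastTwo-suc (toEdge y)
          (subst (λ c → 2 * atLeastTwo (c + toEdge y) ≡ c + toEdge y) cx≡1 pair-tight)))
      where
      cx≡1 : toEdge x ≡ 1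
      cx≡1 = proj₁ (outside-tight x≢u x≢v (att x≢u x≢v))
      pair-tight : 2 * atLeastTwo (toEdge x + toEdge y) ≡ toEdge x + toEdge y
      pair-tight = *-cancelˡ-≡-pos (≤-reflexive (sym (far-outside x≢u x≢v y≢u y≢v xy)))
                     (Equivalence.to farF≡cutPaths⇔ farF≡ x y)

    reach-attached : ∀ {x y} → Reach G x y → Attached x → Attached y
    reach-attached here         = id
    reach-attached (step xw wy) = reach-attached wy ∘ attached-step xw

    toEdge≡1 : ∀ {a} → ¬ a ≡ u → ¬ a ≡ v → toEdge a ≡ 1
    toEdge≡1 {a} a≢u a≢v =
      proj₁ (outside-tight a≢u a≢v (reach-attached (conn u a) (λ u≢u _ → ⊥-elim (u≢u refl)) a≢u a≢v))

    regular : ∀ x → degree G x ≡ Δ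
    regular x with position x
    ... | at-u refl = proj₁ degrees
    ... | at-v refl = proj₂ degrees
    ... | outside x≢u x≢v = trans (degree-split x) (trans (cong (toOff x +_) (toEdge≡1 x≢u x≢v))
          (proj₂ (outside-tight x≢u x≢v (≤-reflexive (sym (toEdge≡1 x≢u x≢v))))))

    covered : ∀ w → adj G u w ≡ true ⊎ adj G v w ≡ true
    covered w with position w
    ... | at-u refl = inj₂ (trans (Graph.sym G v u) uv)
    ... | at-v refl = inj₁ uv
    ... | outside w≢u w≢v with adj G u w | adj G v w | toEdge≡1 w≢u w≢v
    ...   | true  | _    | _ = inj₁ refl
    ...   | false | true | _ = inj₂ refl

    offEdge≡cutAt : ∀ x → offEdge x ≡ cutAt x
    offEdge≡cutAt x with position x
    ... | at-u refl = trans offEdge-u (sym (cutAt-endpoint (inj₁ refl)))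
    ... | at-v refl = trans offEdge-v (sym (cutAt-endpoint (inj₂ refl)))
    ... | outside x≢u x≢v =
      trans (offEdge-outside x≢u x≢v) (sym (trans (cutAt-outside x≢u x≢v) (toEdge≡1 x≢u x≢v)))

    n≡2*Δ : n ≡ 2 * Δ
    n≡2*Δ = begin
      n                         ≡⟨ sym ∑-offEdge+2 ⟩
      sum offEdge + 2           ≡⟨ cong (_+ 2) (sum-cong-≗ offEdge≡cutAt) ⟩
      cut + 2                   ≡⟨ cut+2≡degree+degree ⟩
      degree G u + degree G v   ≡⟨ cong₂ _+_ (proj₁ degrees) (proj₂ degrees) ⟩
      Δ + Δ                     ≡⟨ sym 2*Δ≡Δ+Δ ⟩
      2 * Δ                     ∎
      where open ≡-Reasoning

  family⇒extremal : n ≡ 2 * Δ → (∀ x → degree G x ≡ Δ) →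
    (∀ w → adj G u w ≡ true ⊎ adj G v w ≡ true) → Extremal
  family⇒extremal n≡2*Δ regular covered =
    Equivalence.from farF≡cutPaths⇔ far-tight ,
    Equivalence.from 2*cut+cutPaths≡⇔ cutAt-tight ,
    Equivalence.from cut≡2*Δ∸2⇔ (regular u , regular v)
    where
    cutAt-vanish : ∀ {a k l} → a ≡ u ⊎ a ≡ v → cutAt a * k ≡ cutAt a * l
    cutAt-vanish end rewrite cutAt-endpoint end = refl

    vanish : ∀ {a b k l} → (a ≡ u ⊎ a ≡ v) ⊎ (b ≡ u ⊎ b ≡ v) → far a b * k ≡ far a b * l
    vanish end rewrite far-endpoint end = refl

    1≤toEdge : ∀ x → 1 ≤ toEdge x
    1≤toEdge x with covered x
    ... | inj₁ ux = ≤-trans (≤-reflexive (sym (cong 𝟙 ux))) (m≤m+n (A u x) (A v x))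
    ... | inj₂ vx = ≤-trans (≤-reflexive (sym (cong 𝟙 vx))) (m≤n+m (A v x) (A u x))

    offEdge≤cutAt : ∀ x → offEdge x ≤ cutAt x
    offEdge≤cutAt x = subst (_≤ cutAt x) (*-identityʳ (offEdge x)) (*-monoʳ-≤ (offEdge x) (1≤toEdge x))

    ∑offEdge≡cut : sum offEdge ≡ cut
    ∑offEdge≡cut = +-cancelʳ-≡ 2 (sum offEdge) cut (begin
      sum offEdge + 2           ≡⟨ ∑-offEdge+2 ⟩
      n                         ≡⟨ n≡2*Δ ⟩
      2 * Δ                     ≡⟨ 2*Δ≡Δ+Δ ⟩
      Δ + Δ                     ≡⟨ sym (cong₂ _+_ (regular u) (regular v)) ⟩
      degree G u + degree G v   ≡⟨ sym cut+2≡degree+degree ⟩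
      cut + 2                   ∎)
      where open ≡-Reasoning

    toEdge≡1 : ∀ {a} → ¬ a ≡ u → ¬ a ≡ v → toEdge a ≡ 1
    toEdge≡1 {a} a≢u a≢v = sym (begin
      1            ≡⟨ sym (offEdge-outside a≢u a≢v) ⟩
      offEdge a    ≡⟨ ∑-tight offEdge≤cutAt ∑offEdge≡cut a ⟩
      cutAt a      ≡⟨ cutAt-outside a≢u a≢v ⟩
      toEdge a     ∎)
      where open ≡-Reasoning

    cutAt-tight : ∀ a → cutAt a * (2 + toOff a) ≡ cutAt a * suc Δ
    cutAt-tight a with position a
    ... | at-u a≡u = cutAt-vanish (inj₁ a≡u)
    ... | at-v a≡v = cutAt-vanish (inj₂ a≡v)
    ... | outside a≢u a≢v = cong (cutAt a *_) (cong suc (begin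
      suc (toOff a)        ≡⟨ +-comm 1 (toOff a) ⟩
      toOff a + 1          ≡⟨ cong (toOff a +_) (sym (toEdge≡1 a≢u a≢v)) ⟩
      toOff a + toEdge a   ≡⟨ sym (degree-split a) ⟩
      degree G a           ≡⟨ regular a ⟩
      Δ                    ∎))
      where open ≡-Reasoning

    far-tight : ∀ a b → far a b * (2 * atLeastTwo (toEdge a + toEdge b)) ≡ far a b * (toEdge a + toEdge b)
    far-tight a b with position a | position b
    ... | at-u a≡u | _ = vanish (inj₁ (inj₁ a≡u))
    ... | at-v a≡v | _ = vanish (inj₁ (inj₂ a≡v))
    ... | outside _ _ | at-u b≡u = vanish (inj₂ (inj₁ b≡u))
    ... | outside _ _ | at-v b≡v = vanish (inj₂ (inj₂ b≡v))
    ... | outside a≢u a≢v | outside b≢u b≢v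
      rewrite toEdge≡1 a≢u a≢v | toEdge≡1 b≢u b≢v = refl


lemma3p3 : (n : ℕ) (G : Graph n) → Connected G →
    (∃ λ u → ∃ λ v → (adj G u v ≡ true)
        × (length (F G (u , v)) ≡ maxDegree G * maxDegree G ∸ 1))
    ⇔ InFamily G (maxDegree G)
lemma3p3 n G conn = mk⇔
  (λ (u , v , uv , |F|≡Δ*Δ∸1) → let open AroundEdge G uv in
     extremal⇒InFamily conn (Equivalence.to |F|≡Δ*Δ∸1⇔ |F|≡Δ*Δ∸1))
  (λ (n≡2*Δ , regular , u , v , uv , covered) → let open AroundEdge G uv in
     u , v , uv , Equivalence.from |F|≡Δ*Δ∸1⇔ (family⇒extremal n≡2*Δ regular covered))
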